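{- The CN calculus is sound for epistemic weight models: every formula of $\mathcal{L}_{CN}$ derivable in the CN calculus is true at every world of every epistemic weight model.
   Context: Fix a set $P$ of proposition letters and a finite set $Ag$ of agents. The language $\mathcal{L}_{CN}$ is given by $\phi::=\top\mid p\mid\neg\phi\mid(\phi\wedge\phi)\mid B_a(\phi,\phi)$ with $p\in P$, $a\in Ag$. $\bot,\vee,\to,\leftrightarrow$ are defined as usual; $K_a\phi$ abbreviates $\neg B_a(\neg\phi,\top)$ and $\check K_a\phi$ abbreviates $\neg K_a\neg\phi$. An epistemic weight model is $\mathfrak{M}=(W,R,L,V)$ where $W$ is a non-empty countable set, $R$ assigns to each $a\in Ag$ an equivalence relation $\sim_a$ on $W$ (with $[w]_a$ the class of $w$), $L$ assigns to each $a\in Ag$ a function $\mathbb{L}_a:W\to\mathbb{Q}^+$ (positive rationals) such that $\sum_{u\in[w]_a}\mathbb{L}_a(u)<\infty$ for all $a,w$, and $V:P\to\mathcal{P}(W)$. For $S\subseteq W$ write $\mathbb{L}_a(S)=\sum_{u\in S}\mathbb{L}_a(u)$. Truth: $\top$ always true, $p$ true at $w$ iff $w\in V(p)$, Boolean connectives as usual, and $\mathfrak{M},w\vDash B_a(\phi,\psi)$ iff $\mathbb{L}_a([w]_a\cap\llbracket\phi\wedge\psi\rrbracket_{\mathfrak{M}})>\mathbb{L}_a([w]_a\cap\llbracket\phi\wedge\neg\psi\rrbracket_{\mathfrak{M}})$, where $\llbracket\phi\rrbracket_{\mathfrak{M}}=\{v\mid\mathfrak{M},v\vDash\phi\}$.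 The CN calculus has axioms: (Taut) all propositional tautologies; (Dist-K) $K_a(\phi\to\psi)\to K_a\phi\to K_a\psi$; (T) $K_a\phi\to\phi$; (5B) $B_a(\phi,\psi)\to K_aB_a(\phi,\psi)$; (4B) $\neg B_a(\phi,\psi)\to K_a\neg B_a(\phi,\psi)$; (D) $B_a(\phi,\psi)\to\neg B_a(\phi,\neg\psi)$; (EC) $K_a(\phi\leftrightarrow\psi)\to B_a(\phi,\chi)\to B_a(\psi,\chi)$; (M) $K_a(\phi\to\psi)\to B_a(\chi,\phi)\to B_a(\chi,\psi)$; (C) $B_a(\phi,\psi)\to B_a(\phi,\phi\wedge\psi)$; (SC) $\neg B_a(\chi,\neg\phi)\wedge\check K_a(\chi\wedge\neg\phi\wedge\psi)\to B_a(\chi,\phi\vee\psi)$; rules Modus Ponens and (Nec-K): from $\phi$ infer $K_a\phi$. -}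

module Defs where

open import Data.Nat using (ℕ)
open import Data.Fin using (Fin)
open import Data.Bool using (Bool; true; false; not; _∧_)
open import Data.Rational using (ℚ; 0ℚ; _+_; _<_; _≤_)
open import Data.List using (List; []; _∷_; foldr; map)
open import Data.List.Membership.Propositional using (_∈_)
open import Data.List.Relation.Unary.All using (All)
open import Data.List.Relation.Unary.Unique.Propositional using (Unique)
open import Data.Product using (Σ; _×_; ∃; ∃-syntax)
open import Data.Unit using (⊤)
import Data.Sum
open import Function.Definitions using (Injective)
open import Relation.Binary.Structures using (IsEquivalence)
open import Relation.Binary.PropositionalEquality using (_≡_)
open import Relation.Nullary using (¬_)

module Language (P : Set) (nAg : ℕ) where

  Ag : Set
  Ag = Fin nAg

  data Form : Set where
    ⊤′  : Form
    var : P → Form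
    ¬′_ : Form → Form
    _∧′_ : Form → Form → Form
    B   : Ag → Form → Form → Form

  infix  9 ¬′_
  infixr 7 _∧′_
  infixr 6 _∨′_
  infixr 5 _⇒_
  infix  4 _⇔_

  ⊥′ : Form
  ⊥′ = ¬′ ⊤′

  _∨′_ : Form → Form → Form
  φ ∨′ ψ = ¬′ (¬′ φ ∧′ ¬′ ψ)

  _⇒_ : Form → Form → Form
  φ ⇒ ψ = ¬′ (φ ∧′ ¬′ ψ)

  _⇔_ : Form → Form → Form
  φ ⇔ ψ = (φ ⇒ ψ) ∧′ (ψ ⇒ φ)

  K : Ag → Form → Form
  K a φ = ¬′ B a (¬′ φ) ⊤′

  K̂ : Ag → Form → Form
  K̂ a φ = ¬′ K a (¬′ φ)

  -- Propositional tautologies: propositional formulas over variables ℕ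
  -- that are true under every Boolean valuation; the axiom (Taut) is
  -- every substitution instance of such a formula.

  data PForm : Set where
    p⊤  : PForm
    pv  : ℕ → PForm
    p¬  : PForm → PForm
    p∧  : PForm → PForm → PForm

  evalP : (ℕ → Bool) → PForm → Bool
  evalP v p⊤ = true
  evalP v (pv n) = v n
  evalP v (p¬ χ) = not (evalP v χ)
  evalP v (p∧ χ θ) = evalP v χ ∧ evalP v θ

  Tautology : PForm → Set
  Tautology χ = (v : ℕ → Bool) → evalP v χ ≡ true

  substP : (ℕ → Form) → PForm → Form
  substP σ p⊤ = ⊤′
  substP σ (pv n) = σ n
  substP σ (p¬ χ) = ¬′ substP σ χ
  substP σ (p∧ χ θ) = substP σ χ ∧′ substP σ θ

  data CN : Form → Set where
    taut   : (χ : PForm) → Tautology χ → (σ : ℕ → Form) → CN (substP σ χ)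
    distK  : ∀ a φ ψ → CN (K a (φ ⇒ ψ) ⇒ K a φ ⇒ K a ψ)
    axT    : ∀ a φ → CN (K a φ ⇒ φ)
    ax5B   : ∀ a φ ψ → CN (B a φ ψ ⇒ K a (B a φ ψ))
    ax4B   : ∀ a φ ψ → CN (¬′ B a φ ψ ⇒ K a (¬′ B a φ ψ))
    axD    : ∀ a φ ψ → CN (B a φ ψ ⇒ ¬′ B a φ (¬′ ψ))
    axEC   : ∀ a φ ψ χ → CN (K a (φ ⇔ ψ) ⇒ B a φ χ ⇒ B a ψ χ)
    axM    : ∀ a φ ψ χ → CN (K a (φ ⇒ ψ) ⇒ B a χ φ ⇒ B a χ ψ)
    axC    : ∀ a φ ψ → CN (B a φ ψ ⇒ B a φ (φ ∧′ ψ))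
    axSC   : ∀ a φ ψ χ →
             CN ((¬′ B a χ (¬′ φ) ∧′ K̂ a (χ ∧′ ¬′ φ ∧′ ψ)) ⇒ B a χ (φ ∨′ ψ))
    mp     : ∀ {φ ψ} → CN (φ ⇒ ψ) → CN φ → CN ψ
    necK   : ∀ a {φ} → CN φ → CN (K a φ)

  Σℚ : List ℚ → ℚ
  Σℚ = foldr _+_ 0ℚ

  record Model : Set₁ where
    field
      W        : Set
      inhabited : W
      -- countable: W injects into ℕ
      code     : W → ℕ
      code-inj : Injective _≡_ _≡_ code
      R        : Ag → W → W → Set
      R-equiv  : (a : Ag) → IsEquivalence (R a)
      weight   : Ag → W → ℚ
      weight-pos : (a : Ag) (w : W) → 0ℚ < weight a w
      V        : P → W → Set

    FinSub : (W → Set) → List W → Set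
    FinSub S xs = Unique xs × All S xs

    Lsum : Ag → List W → ℚ
    Lsum a xs = Σℚ (map (weight a) xs)

    -- "L_a(S) ≤ q": every finite partial sum of the (unordered, positive)
    -- series Σ_{u∈S} L_a(u) is ≤ q, i.e. the sum (= sup of finite partial
    -- sums) is at most q.
    SumLe : Ag → (W → Set) → ℚ → Set
    SumLe a S q = ∀ xs → FinSub S xs → Lsum a xs ≤ q

    -- "L_a(S) > L_a(T)" for subsets with finite sums: some finite partial sum
    -- of S exceeds a rational upper bound of L_a(T).
    SumGt : Ag → (W → Set) → (W → Set) → Set
    SumGt a S T = ∃[ xs ] ∃[ q ] (FinSub S xs × q < Lsum a xs × SumLe a T q)

    field
      finite-sum : (a : Ag) (w : W) → ∃[ q ] SumLe a (R a w) q

  open Model public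

  sat : (M : Model) → W M → Form → Set
  sat M w ⊤′ = ⊤
  sat M w (var p) = V M p w
  sat M w (¬′ φ) = ¬ sat M w φ
  sat M w (φ ∧′ ψ) = sat M w φ × sat M w ψ
  sat M w (B a φ ψ) =
    SumGt M a (λ v → R M a w v × (sat M v φ × sat M v ψ))
              (λ v → R M a w v × (sat M v φ × ¬ sat M v ψ))

  -- Classical metatheory (the paper reasons classically)
  ExcludedMiddle : Set₁
  ExcludedMiddle = (A : Set) → A Data.Sum.⊎ ¬ A

module Submission where

-- Validity of each axiom is checked directly against the semantics, reasoning classically with the
-- given excluded middle. K_a φ holds at w iff φ holds throughout [w]_a, since one world of positive
-- weight outweighs the empty set; B-formulas only depend on [w]_a; and (D), (EC), (M), (C) are
-- asymmetry and monotonicity of the weight comparison. The one quantitative axiom is (SC): by the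
-- Archimedean property of ℚ, the convergent sum L_a([w]_a ∩ χ ∧ φ) is approximated within L_a(u) by a
-- finite partial sum s, where u is a χ ∧ ¬φ ∧ ψ world. Then ¬B_a(χ, ¬φ) gives
-- L_a([w]_a ∩ χ ∧ ¬φ) ≤ L_a(u) + s, and as [w]_a ∩ χ ∧ ¬(φ ∨ ψ) lies in that set minus u, its weight
-- is at most s < L_a(u) + s, the weight of u and the worlds counted in s, all χ ∧ (φ ∨ ψ) worlds.

open import Defs
open import Data.Bool using (Bool)
open import Data.Empty using (⊥-elim)
open import Data.Integer as ℤ using (+_; +0; +[1+_]; -[1+_]; +<+; +≤+; -≤+)
import Data.Integer.Properties as ℤ
open import Data.Integer.Tactic.RingSolver using (solve-∀)
open import Data.List using (List; []; _∷_)
open import Data.List.Relation.Unary.All as All using ([]; _∷_)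
open import Data.List.Relation.Unary.AllPairs using ([]; _∷_)
open import Data.Nat as ℕ using (ℕ; zero; suc)
import Data.Nat.Properties as ℕ
open import Data.Nat.Coprimality using (Coprime)
open import Data.Product using (_×_; _,_; proj₁; proj₂; ∃; ∃-syntax)
open import Data.Rational using (ℚ; mkℚ; 0ℚ; _+_; _<_; _≤_; *<*; toℚᵘ; +-0-rawMonoid)
open import Data.Rational.Properties
  using (≤-refl; ≤-trans; <-≤-trans; ≤-<-trans; <-irrefl; <⇒≤; ≮⇒≥;
         +-identityʳ; +-identityˡ; +-monoˡ-<; +-monoʳ-<; +-monoʳ-≤;
         <-respʳ-≡; toℚᵘ-homo-+; toℚᵘ-cancel-<; module ≤-Reasoning)
import Data.Rational.Unnormalised as ℚᵘ
import Data.Rational.Unnormalised.Properties as ℚᵘ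
open import Data.Unit using (tt)
open import Relation.Binary.PropositionalEquality using (_≡_; refl; cong; subst; sym; trans)
open import Relation.Binary.Structures using (IsEquivalence)
open import Relation.Nullary using (¬_; Dec; does; proof)
open import Relation.Nullary.Decidable using (decidable-stable; fromSum)
open import Relation.Nullary.Reflects using (Reflects; ofʸ; invert; ¬-reflects; _×-reflects_)
open import Relation.Unary using (_⊆_)

open import Algebra.Definitions.RawMonoid +-0-rawMonoid using () renaming (_×_ to _·_)

<⇒≱ : ∀ {p q} → p < q → ¬ q ≤ p
<⇒≱ p<q q≤p = <-irrefl refl (<-≤-trans p<q q≤p)

+-cancelˡ-≤ : ∀ r {p q} → r + p ≤ r + q → p ≤ q
+-cancelˡ-≤ r r+p≤r+q = ≮⇒≥ λ q<p → <⇒≱ (+-monoʳ-< r q<p) r+p≤r+q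

p<r+p : ∀ {p r} → 0ℚ < r → p < r + p
p<r+p {p} {r} 0<r = subst (_< r + p) (+-identityˡ p) (+-monoˡ-< p 0<r)

i≤+∣i∣ : ∀ i → i ℤ.≤ + ℤ.∣ i ∣
i≤+∣i∣ (+ n)    = +≤+ ℕ.≤-refl
i≤+∣i∣ -[1+ n ] = -≤+

·-toℚᵘ : ∀ n e d .(c : Coprime ℤ.∣ e ∣ (suc d)) → toℚᵘ (n · mkℚ e d c) ℚᵘ.≃ ℚᵘ.mkℚᵘ (+ n ℤ.* e) d
·-toℚᵘ zero    e d c = ℚᵘ.*≡* (cong (ℤ._* + 1) (sym (ℤ.*-zeroˡ e)))
·-toℚᵘ (suc n) e d c = begin-equality
  toℚᵘ (ε + n · ε)                                     ≃⟨ toℚᵘ-homo-+ ε (n · ε) ⟩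
  ℚᵘ.mkℚᵘ e d ℚᵘ.+ toℚᵘ (n · ε)                        ≃⟨ ℚᵘ.+-congʳ (ℚᵘ.mkℚᵘ e d) (·-toℚᵘ n e d c) ⟩
  ℚᵘ.mkℚᵘ e d ℚᵘ.+ ℚᵘ.mkℚᵘ (+ n ℤ.* e) d              ≃⟨ ℚᵘ.*≡* same-denominator ⟩
  ℚᵘ.mkℚᵘ (+ suc n ℤ.* e) d                            ∎
  where
  open ℚᵘ.≤-Reasoning
  ε = mkℚ e d c
  D = suc d
  same-denominator : (e ℤ.* + D ℤ.+ (+ n ℤ.* e) ℤ.* + D) ℤ.* + D ≡ (+ suc n ℤ.* e) ℤ.* + (D ℕ.* D)
  same-denominator = trans (distrib e (+ n) (+ D)) (cong ((+ suc n ℤ.* e) ℤ.*_) (sym (ℤ.pos-* D D)))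
    where
    distrib : ∀ e m D → (e ℤ.* D ℤ.+ (m ℤ.* e) ℤ.* D) ℤ.* D ≡ ((+ 1 ℤ.+ m) ℤ.* e) ℤ.* (D ℤ.* D)
    distrib = solve-∀

archimedean : ∀ q ε → 0ℚ < ε → ∃[ n ] q < n · ε
archimedean q (mkℚ +0 d c) (*<* (+<+ ()))
archimedean q (mkℚ -[1+ e ] d c) (*<* ())
archimedean (mkℚ a b _) (mkℚ +[1+ e ] d c) _ =
  n , toℚᵘ-cancel-< (ℚᵘ.<-respʳ-≃ (ℚᵘ.≃-sym (·-toℚᵘ n +[1+ e ] d c)) (ℚᵘ.*<* cross-multiplied))
  where
  open ℤ.≤-Reasoning
  n = suc (ℤ.∣ a ∣ ℕ.* suc d)
  cross-multiplied : a ℤ.* + suc d ℤ.< (+ n ℤ.* +[1+ e ]) ℤ.* + suc b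
  cross-multiplied = begin-strict
    a ℤ.* + suc d                  ≤⟨ ℤ.*-monoʳ-≤-nonNeg (+ suc d) (i≤+∣i∣ a) ⟩
    + ℤ.∣ a ∣ ℤ.* + suc d          ≡⟨ ℤ.pos-* ℤ.∣ a ∣ (suc d) ⟨
    + (ℤ.∣ a ∣ ℕ.* suc d)          <⟨ +<+ (ℕ.n<1+n _) ⟩
    + n                            ≤⟨ +≤+ (ℕ.≤-trans (ℕ.m≤m*n n (suc e)) (ℕ.m≤m*n (n ℕ.* suc e) (suc b))) ⟩
    + (n ℕ.* suc e ℕ.* suc b)      ≡⟨ ℤ.pos-* (n ℕ.* suc e) (suc b) ⟩
    + (n ℕ.* suc e) ℤ.* + suc b    ≡⟨ cong (ℤ._* + suc b) (ℤ.pos-* n (suc e)) ⟩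
    (+ n ℤ.* +[1+ e ]) ℤ.* + suc b ∎

module Soun¬¬-elimss (P : Set) (nAg : ℕ) (em : Language.ExcludedMiddle P nAg) where
  open Language P nAg
    hiding (W; R; R-equiv; weight; weight-pos; FinSub; Lsum; SumLe; SumGt; finite-sum)

  decide : (A : Set) → Dec A
  decide A = fromSum (em A)

  ¬¬-elim : {A : Set} → ¬ ¬ A → A
  ¬¬-elim {A} = decidable-stable (decide A)

  ⇒-intro : {A B : Set} → (A → B) → ¬ (A × ¬ B)
  ⇒-intro f (a , ¬b) = ¬b (f a)

  ⇒-elim : {A B : Set} → ¬ (A × ¬ B) → A → B
  ⇒-elim ¬[a∧¬b] a = ¬¬-elim λ ¬b → ¬[a∧¬b] (a , ¬b)

  module _ (M : Model) where
    open Model M using (W; R; R-equiv; weight; weight-pos; FinSub; Lsum; SumLe; SumGt; finite-sum)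

    private variable
      a : Ag
      q ε : ℚ
      u v w : W
      φ : Form
      S S′ T T′ : W → Set
      xs : List W

    module _ {a : Ag} where
      open IsEquivalence (R-equiv a) public using ()
        renaming (refl to ∼-refl; sym to ∼-sym; trans to ∼-trans)

    FinSub-mono : S ⊆ S′ → FinSub S xs → FinSub S′ xs
    FinSub-mono S⊆S′ (unique , all) = unique , All.map S⊆S′ all

    FinSub-∷ : S′ u → S ⊆ S′ → ¬ S u → FinSub S xs → FinSub S′ (u ∷ xs)
    FinSub-∷ S′u S⊆S′ ¬Su (unique , all) =
      All.map (λ Sv u≡v → ¬Su (subst _ (sym u≡v) Sv)) all ∷ unique , S′u ∷ All.map S⊆S′ all

    SumLe-anti : S ⊆ S′ → SumLe a S′ q → SumLe a S q
    SumLe-anti S⊆S′ S′≤q xs fxs = S′≤q xs (FinSub-mono S⊆S′ fxs)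

    SumLe-empty : (∀ {v} → ¬ S v) → SumLe a S 0ℚ
    SumLe-empty S-empty []      _            = ≤-refl
    SumLe-empty S-empty (_ ∷ _) (_ , Sx ∷ _) = ⊥-elim (S-empty Sx)

    SumGt-mono : S ⊆ S′ → T′ ⊆ T → SumGt a S T → SumGt a S′ T′
    SumGt-mono S⊆S′ T′⊆T (xs , q , fxs , q<xs , T≤q) =
      xs , q , FinSub-mono S⊆S′ fxs , q<xs , SumLe-anti T′⊆T T≤q

    SumGt-asym : SumGt a S T → ¬ SumGt a T S
    SumGt-asym {a = a} (xs , q , fxs , q<xs , T≤q) (ys , r , fys , r<ys , S≤r) =
      <-irrefl refl (begin-strict
        q         <⟨ q<xs ⟩
        Lsum a xs ≤⟨ S≤r xs fxs ⟩
        r         <⟨ r<ys ⟩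
        Lsum a ys ≤⟨ T≤q ys fys ⟩
        q         ∎)
      where open ≤-Reasoning

    SumGt-inhabited : SumGt a S T → ∃ S
    SumGt-inhabited ([]    , q , _            , q<0 , T≤q) = ⊥-elim (<⇒≱ q<0 (T≤q [] ([] , [])))
    SumGt-inhabited (x ∷ _ , _ , (_ , Sx ∷ _) , _   , _)   = x , Sx

    singleton-SumGt : S v → (∀ {u} → ¬ T u) → SumGt a S T
    singleton-SumGt {v = v} {a = a} Sv T-empty =
      v ∷ [] , 0ℚ , ([] ∷ [] , Sv ∷ []) ,
      <-respʳ-≡ (sym (+-identityʳ _)) (weight-pos a v) , SumLe-empty T-empty

    ¬SumGt⇒SumLe : ¬ SumGt a S T → SumLe a T q → SumLe a S q
    ¬SumGt⇒SumLe ¬S>T T≤q xs fxs = ≮⇒≥ λ q<xs → ¬S>T (xs , _ , fxs , q<xs , T≤q)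

    ¬SumLe⇒exceeds : ¬ SumLe a S q → ∃[ xs ] (FinSub S xs × q < Lsum a xs)
    ¬SumLe⇒exceeds ¬S≤q = ¬¬-elim λ ∄ → ¬S≤q λ xs fxs → ≮⇒≥ λ q<xs → ∄ (xs , fxs , q<xs)

    exceedable⇒unbounded :
      (∀ xs → FinSub S xs → ∃[ ys ] (FinSub S ys × ε + Lsum a xs < Lsum a ys)) →
      ∀ n → ∃[ ys ] (FinSub S ys × n · ε ≤ Lsum a ys)
    exceedable⇒unbounded exceed zero    = [] , ([] , []) , ≤-refl
    exceedable⇒unbounded {ε = ε} exceed (suc n) =
      let ys , fys , nε≤ys = exceedable⇒unbounded exceed n
          zs , fzs , ε+ys<zs = exceed ys fys
      in zs , fzs , <⇒≤ (≤-<-trans (+-monoʳ-≤ ε nε≤ys) ε+ys<zs)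

    SumLe-approx : 0ℚ < ε → SumLe a S q → ∃[ xs ] (FinSub S xs × SumLe a S (ε + Lsum a xs))
    SumLe-approx {ε = ε} {q = q} 0<ε S≤q = ¬¬-elim λ ∄ →
      let n , q<nε = archimedean q ε 0<ε
          exceed xs fxs = ¬SumLe⇒exceeds λ S≤ → ∄ (xs , fxs , S≤)
          ys , fys , nε≤ys = exceedable⇒unbounded exceed n
      in <⇒≱ q<nε (≤-trans nε≤ys (S≤q ys fys))

    infix 4 _⊨_
    _⊨_ : W → Form → Set
    w ⊨ φ = sat M w φ

    K-intro : ∀ φ → (∀ {v} → R a w v → v ⊨ φ) → w ⊨ K a φ
    K-intro φ ∀φ ∃¬φ = let _ , r , ¬φv , _ = SumGt-inhabited ∃¬φ in ¬φv (∀φ r)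

    K-elim : ∀ φ → w ⊨ K a φ → R a w v → v ⊨ φ
    K-elim φ Kφ r = ¬¬-elim λ ¬φv → Kφ (singleton-SumGt (r , ¬φv , tt) λ (_ , _ , ¬⊤) → ¬⊤ tt)

    K̂-elim : ∀ φ → w ⊨ K̂ a φ → ∃[ v ] (R a w v × v ⊨ φ)
    K̂-elim φ K̂φ = ¬¬-elim λ ∄ → K̂φ (K-intro (¬′ φ) λ r φv → ∄ (_ , r , φv))

    B-local : ∀ φ ψ → R a w v → w ⊨ B a φ ψ → v ⊨ B a φ ψ
    B-local φ ψ w∼v =
      SumGt-mono (λ (w∼u , x) → ∼-trans (∼-sym w∼v) w∼u , x) (λ (v∼u , x) → ∼-trans w∼v v∼u , x)

    module _ (w : W) (σ : ℕ → Form) where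
      valuation : ℕ → Bool
      valuation n = does (decide (w ⊨ σ n))

      substP-reflects : ∀ χ → Reflects (w ⊨ substP σ χ) (evalP valuation χ)
      substP-reflects p⊤       = ofʸ tt
      substP-reflects (pv n)   = proof (decide (w ⊨ σ n))
      substP-reflects (p¬ χ)   = ¬-reflects (substP-reflects χ)
      substP-reflects (p∧ χ θ) = substP-reflects χ ×-reflects substP-reflects θ

    taut-valid : ∀ χ → Tautology χ → ∀ σ w → w ⊨ substP σ χ
    taut-valid χ χ-taut σ w =
      invert (subst (Reflects _) (χ-taut (valuation w σ)) (substP-reflects w σ χ))

    SC-valid : ∀ φ ψ χ → w ⊨ ¬′ B a χ (¬′ φ) → w ⊨ K̂ a (χ ∧′ ¬′ φ ∧′ ψ) →
               w ⊨ B a χ (φ ∨′ ψ)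
    SC-valid {w = w} {a = a} φ ψ χ ¬B K̂θ with K̂-elim (χ ∧′ ¬′ φ ∧′ ψ) K̂θ
    ... | u , w∼u , χu , ¬φu , ψu =
      u ∷ xs₀ , Lsum a xs₀ ,
      FinSub-∷ (w∼u , χu , λ (_ , ¬ψu) → ¬ψu ψu) ¬¬φ⊆φ∨ψ (λ (_ , _ , ¬¬φu) → ¬¬φu ¬φu) fxs₀ ,
      p<r+p (weight-pos a u) ,
      λ zs fzs → +-cancelˡ-≤ (weight a u) (¬φ≤ (u ∷ zs)
        (FinSub-∷ (w∼u , χu , ¬φu) ¬[φ∨ψ]⊆¬φ (λ (_ , _ , ¬[φ∨ψ]u) → ¬[φ∨ψ]u λ (_ , ¬ψu) → ¬ψu ψu) fzs))
      where
      _∩χ : (W → Set) → W → Set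
      (S ∩χ) v = R a w v × (v ⊨ χ × S v)

      ¬¬φ⊆φ∨ψ : (λ v → ¬ ¬ v ⊨ φ) ∩χ ⊆ (_⊨ (φ ∨′ ψ)) ∩χ
      ¬¬φ⊆φ∨ψ (r , χv , ¬¬φv) = r , χv , λ (¬φv , _) → ¬¬φv ¬φv

      ¬[φ∨ψ]⊆¬φ : (λ v → ¬ v ⊨ (φ ∨′ ψ)) ∩χ ⊆ (λ v → ¬ v ⊨ φ) ∩χ
      ¬[φ∨ψ]⊆¬φ (r , χv , ¬[φ∨ψ]v) = r , χv , λ φv → ¬[φ∨ψ]v λ (¬φv , _) → ¬φv φv

      approx : ∃[ xs ] (FinSub ((λ v → ¬ ¬ v ⊨ φ) ∩χ) xs ×
                        SumLe a ((λ v → ¬ ¬ v ⊨ φ) ∩χ) (weight a u + Lsum a xs))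
      approx = SumLe-approx (weight-pos a u) (SumLe-anti proj₁ (proj₂ (finite-sum a w)))

      xs₀ : List W
      xs₀ = proj₁ approx

      fxs₀ : FinSub ((λ v → ¬ ¬ v ⊨ φ) ∩χ) xs₀
      fxs₀ = proj₁ (proj₂ approx)

      ¬φ≤ : SumLe a ((λ v → ¬ v ⊨ φ) ∩χ) (weight a u + Lsum a xs₀)
      ¬φ≤ = ¬SumGt⇒SumLe ¬B (proj₂ (proj₂ approx))

    valid : CN φ → ∀ w → w ⊨ φ
    valid (taut χ χ-taut σ) w = taut-valid χ χ-taut σ w
    valid (distK a φ ψ) w = ⇒-intro λ K[φ⇒ψ] → ⇒-intro λ Kφ →
      K-intro ψ λ r → ⇒-elim (K-elim (φ ⇒ ψ) K[φ⇒ψ] r) (K-elim φ Kφ r)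
    valid (axT a φ) w = ⇒-intro λ Kφ → K-elim φ Kφ ∼-refl
    valid (ax5B a φ ψ) w = ⇒-intro λ Bφψ → K-intro (B a φ ψ) λ r → B-local φ ψ r Bφψ
    valid (ax4B a φ ψ) w = ⇒-intro λ ¬Bφψ →
      K-intro (¬′ B a φ ψ) λ r Bφψ → ¬Bφψ (B-local φ ψ (∼-sym r) Bφψ)
    valid (axD a φ ψ) w = ⇒-intro λ Bφψ →
      SumGt-asym (SumGt-mono (λ (r , φv , ψv) → r , φv , λ ¬ψv → ¬ψv ψv) (λ x → x) Bφψ)
    valid (axEC a φ ψ χ) w = ⇒-intro λ K[φ⇔ψ] → ⇒-intro λ Bφχ →
      SumGt-mono (λ (r , φv , χv) → r , ⇒-elim (proj₁ (K-elim (φ ⇔ ψ) K[φ⇔ψ] r)) φv , χv)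
                 (λ (r , ψv , ¬χv) → r , ⇒-elim (proj₂ (K-elim (φ ⇔ ψ) K[φ⇔ψ] r)) ψv , ¬χv) Bφχ
    valid (axM a φ ψ χ) w = ⇒-intro λ K[φ⇒ψ] → ⇒-intro λ Bχφ →
      SumGt-mono (λ (r , χv , φv) → r , χv , ⇒-elim (K-elim (φ ⇒ ψ) K[φ⇒ψ] r) φv)
                 (λ (r , χv , ¬ψv) → r , χv , λ φv → ¬ψv (⇒-elim (K-elim (φ ⇒ ψ) K[φ⇒ψ] r) φv)) Bχφ
    valid (axC a φ ψ) w = ⇒-intro λ Bφψ →
      SumGt-mono (λ (r , φv , ψv) → r , φv , φv , ψv)
                 (λ (r , φv , ¬[φ∧ψ]v) → r , φv , λ ψv → ¬[φ∧ψ]v (φv , ψv)) Bφψ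
    valid (axSC a φ ψ χ) w = ⇒-intro λ (¬B , K̂θ) → SC-valid φ ψ χ ¬B K̂θ
    valid (mp ⊢φ⇒ψ ⊢φ) w = ⇒-elim (valid ⊢φ⇒ψ w) (valid ⊢φ w)
    valid (necK a {φ} ⊢φ) w = K-intro φ λ {v} _ → valid ⊢φ v

theorem2 : (P : Set) (nAg : ℕ) → Language.ExcludedMiddle P nAg →
    (φ : Language.Form P nAg) → Language.CN P nAg φ →
    (M : Language.Model P nAg) (w : Language.W M) → Language.sat P nAg M w φ
theorem2 P nAg em φ ⊢φ M w = Soun¬¬-elimss.valid P nAg em M ⊢φ w
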